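{- Let $\alpha$ be a composition, $w=\mathfrak{t}_{i_1}\cdots\mathfrak{t}_{i_n}\in CRHW_n$ with $w(\alpha)=\beta\ne0$, and $\tau$ the filling of $\beta/\!\!/\alpha$ corresponding to $w$. Let $j\ge1$ belong to $\mathrm{supp}(w)$ but not be its greatest element. If $j\notin\mathrm{leg}(w)$, then the greatest entry of $\tau$ in column $j$ is strictly less than the smallest entry of $\tau$ in column $j+1$.
   Context: A composition is a finite sequence of positive integers; its diagram has $\alpha_i$ left-justified boxes in row $i$, rows numbered top to bottom. Box-adding operators: $\mathfrak{t}_1(\alpha)=(1,\alpha_1,\ldots,\alpha_k)$ (a new top row of one box, previous rows moving down one); for $i\ge2$, $\mathfrak{t}_i(\alpha)$ adds one box at the end of the topmost row of length $i-1$ (in column $i$) if one exists, else is $0$; $\mathfrak{t}_i(0)=0$. A word $w=\mathfrak{t}_{i_1}\cdots\mathfrak{t}_{i_n}$ acts by applying $\mathfrak{t}_{i_n}$ first. For $0\le k\le n-1$, $w$ is a reverse $k$-hookword if $i_1\le\cdots\le i_{k+1}>i_{k+2}>\cdots>i_n$; then $\mathrm{leg}(w)=\{i_{k+1},\ldots,i_n\}$ and $\mathrm{supp}(w)=\{i_1,\ldots,i_n\}$; $w$ is connected if $\mathrm{supp}(w)$ is a set of consecutive integers; $CRHW_n$ is the set of connected reverse hookwords of length $n$. If $w(\alpha)=\beta\ne0$, the boxes added during the successive applications form the skew shape $\beta/\!\!/\alpha$ (the diagram of $\beta$ minus the diagram of $\alpha$ placed in the bottom $l(\alpha)$ rows);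 the filling $\tau$ corresponding to $w$ places $n-m+1$ in the $m$-th box added. Columns of $\tau$ refer to the boxes of $\beta/\!\!/\alpha$ in a given column. -}

module Defs where

open import Data.Nat using (ℕ; zero; suc; _+_; _∸_; _≤_; _<_; _≡ᵇ_)
open import Data.Bool using (if_then_else_)
open import Data.List using (List; []; _∷_; length; reverse; map; _++_; [_])
open import Data.Maybe using (Maybe; just; nothing; _>>=_)
open import Data.Product using (_×_; _,_; ∃; ∃-syntax)
open import Relation.Binary.PropositionalEquality using (_≡_)
open import Data.List.Membership.Propositional using (_∈_)

-- A composition is a list of positive naturals (positivity imposed as a hypothesis).
Composition : Set
Composition = List ℕ

-- A box of the filling: (row , column , entry); rows/columns 1-indexed,
-- rows numbered top to bottom in the current diagram.
Box : Set
Box = ℕ × ℕ × ℕ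

State : Set
State = Composition × List Box

addAt : ℕ → Composition → Maybe (ℕ × Composition)
addAt L [] = nothing
addAt L (x ∷ xs) =
  if x ≡ᵇ L then just (1 , suc x ∷ xs)
  else (addAt L xs >>= λ { (r , ys) → just (suc r , x ∷ ys) })

shiftDown : Box → Box
shiftDown (r , c , e) = (suc r , c , e)

step : ℕ → ℕ → State → Maybe State
step zero e s = nothing
step (suc zero) e (α , bs) = just (1 ∷ α , map shiftDown bs ++ [ (1 , 1 , e) ])
step (suc (suc m)) e (α , bs) =
  addAt (suc m) α >>= λ { (r , α') → just (α' , bs ++ [ (r , suc (suc m) , e) ]) }

applyFrom : ℕ → ℕ → List ℕ → State → Maybe State
applyFrom n m [] s = just s
applyFrom n m (i ∷ is) s = step i ((n ∸ m) + 1) s >>= applyFrom n (suc m) is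

-- w = t_{i_1} ... t_{i_n} given as the list [i_1 , ... , i_n]; t_{i_n} acts first.
-- Result: just (β , τ) with β = w(α) and τ the filling of β//α, or nothing if w(α) = 0.
run : List ℕ → Composition → Maybe State
run w α = applyFrom (length w) 1 (reverse w) (α , [])

-- total 0-indexed lookup (default 0)
_!_ : List ℕ → ℕ → ℕ
[] ! _ = 0
(x ∷ xs) ! zero = x
(x ∷ xs) ! suc p = xs ! p

-- reverse k-hookword: i_1 ≤ ... ≤ i_{k+1} > i_{k+2} > ... > i_n, 0 ≤ k ≤ n-1
-- (positions below are 0-indexed: position p holds i_{p+1})
IsRevHookword : ℕ → List ℕ → Set
IsRevHookword k w =
  (k < length w)
  × (∀ p → suc p ≤ k → (w ! p) ≤ (w ! suc p))
  × (∀ p → k ≤ p → suc p < length w → (w ! suc p) < (w ! p))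

InSupp : List ℕ → ℕ → Set
InSupp w j = ∃[ p ] (p < length w × w ! p ≡ j)

InLeg : ℕ → List ℕ → ℕ → Set
InLeg k w j = ∃[ p ] (k ≤ p × p < length w × w ! p ≡ j)

Connected : List ℕ → Set
Connected w = ∀ a b c → InSupp w a → InSupp w c → a ≤ b → b ≤ c → InSupp w b

InColumn : List Box → ℕ → ℕ → Set
InColumn τ c e = ∃[ r ] ((r , c , e) ∈ τ)

-- The letter i_{p+1} of w is applied (n − p)-th, so the box it adds gets entry p + 1 and lies in
-- column i_{p+1}.  Hence an entry of column j is p + 1 for some p with i_{p+1} = j, and an entry of
-- column j + 1 is q + 1 with i_{q+1} = j + 1.  As j is not in the leg, p lies in the weakly
-- increasing part i_1 ≤ ⋯ ≤ i_{k+1}; if q ≤ p then q lies there too, forcing j + 1 ≤ j.  So p < q.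
module Submission where

open import Defs
open import Data.Nat using (ℕ; zero; suc; _+_; _∸_; _≤_; _<_; z≤n; s≤s)
open import Data.Nat.Properties
open import Data.List using (List; []; _∷_; length; reverse; _++_; [_])
open import Data.List.Properties using (unfold-reverse; length-reverse)
open import Data.List.Relation.Unary.All using (All; []; lookup)
open import Data.List.Relation.Unary.All.Properties using (∷ʳ⁺; map⁺)
open import Data.Maybe using (just)
open import Data.Product using (_×_; _,_; ∃-syntax; proj₂)
open import Data.Sum using (inj₁; inj₂)
open import Data.Empty using (⊥-elim)
open import Relation.Binary.PropositionalEquality using (_≡_; refl; sym; trans; cong; subst; subst₂)
open import Relation.Nullary using (¬_; yes; no)

!-++ˡ : ∀ (xs ys : List ℕ) {t} → t < length xs → (xs ++ ys) ! t ≡ xs ! t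
!-++ˡ (x ∷ xs) ys {zero}  _         = refl
!-++ˡ (x ∷ xs) ys {suc t} (s≤s t<n) = !-++ˡ xs ys t<n

!-∷ʳ-length : ∀ (xs : List ℕ) y → (xs ++ [ y ]) ! length xs ≡ y
!-∷ʳ-length []       y = refl
!-∷ʳ-length (x ∷ xs) y = !-∷ʳ-length xs y

reverse-! : ∀ (xs : List ℕ) {t} → t < length xs → reverse xs ! t ≡ xs ! (length xs ∸ suc t)
reverse-! (x ∷ xs) {t} (s≤s t≤n) rewrite unfold-reverse x xs with m≤n⇒m<n∨m≡n t≤n
... | inj₁ t<n = trans (!-++ˡ (reverse xs) [ x ] (subst (t <_) (sym (length-reverse xs)) t<n))
                       (trans (reverse-! xs t<n) (cong ((x ∷ xs) !_) (suc-∸-suc t<n)))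
  where
  suc-∸-suc : ∀ {m n} → m < n → suc (n ∸ suc m) ≡ n ∸ m
  suc-∸-suc {zero}  {suc n} _         = refl
  suc-∸-suc {suc m} {suc n} (s≤s m<n) = suc-∸-suc m<n
... | inj₂ refl = trans (subst (λ i → (reverse xs ++ [ x ]) ! i ≡ x) (length-reverse xs)
                               (!-∷ʳ-length (reverse xs) x))
                        (cong ((x ∷ xs) !_) (sym (n∸n≡0 (length xs))))

!-mono-≤-below : ∀ (w : List ℕ) k → (∀ p → suc p ≤ k → w ! p ≤ w ! suc p)
               → ∀ {q p} → q ≤ p → p ≤ k → w ! q ≤ w ! p
!-mono-≤-below w k inc {p = zero}  z≤n    _   = ≤-refl
!-mono-≤-below w k inc {p = suc p} q≤1+p 1+p≤k with m≤n⇒m<n∨m≡n q≤1+p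
... | inj₂ refl      = ≤-refl
... | inj₁ (s≤s q≤p) = ≤-trans (!-mono-≤-below w k inc q≤p (≤-trans (n≤1+n p) 1+p≤k)) (inc p 1+p≤k)

-- p is the 0-indexed position in w of the letter that added the box.
LetterEntry : List ℕ → ℕ → ℕ → Set
LetterEntry w c e = ∃[ p ] (p < length w × w ! p ≡ c × e ≡ suc p)

OnColumnEntry : (ℕ → ℕ → Set) → Box → Set
OnColumnEntry P (_ , c , e) = P c e

step-preserves : ∀ {P} i e {α bs α′ bs′} → step i e (α , bs) ≡ just (α′ , bs′)
               → All (OnColumnEntry P) bs → P i e → All (OnColumnEntry P) bs′
step-preserves (suc zero) e refl Pbs Pie = ∷ʳ⁺ (map⁺ Pbs) Pie
step-preserves (suc (suc m)) e {α} eq Pbs Pie with addAt (suc m) α | eq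
... | just _ | refl = ∷ʳ⁺ Pbs Pie

applyFrom-preserves : ∀ {P} n m is {s s′} → applyFrom n m is s ≡ just s′
                    → All (OnColumnEntry P) (proj₂ s)
                    → (∀ t → t < length is → P (is ! t) (n ∸ (m + t) + 1))
                    → All (OnColumnEntry P) (proj₂ s′)
applyFrom-preserves n m [] refl Ps _ = Ps
applyFrom-preserves {P} n m (i ∷ is) {α , bs} eq Ps Pis with step i (n ∸ m + 1) (α , bs) in stepEq | eq
... | just s₁ | eq₁ = applyFrom-preserves n (suc m) is eq₁ (step-preserves i _ stepEq Ps Pi) Pis′
  where
  Pi : P i (n ∸ m + 1)
  Pi = subst (λ x → P i (n ∸ x + 1)) (+-identityʳ m) (Pis 0 (s≤s z≤n))
  Pis′ : ∀ t → t < length is → P (is ! t) (n ∸ (suc m + t) + 1)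
  Pis′ t t<n = subst (λ x → P (is ! t) (n ∸ x + 1)) (+-suc m t) (Pis (suc t) (s≤s t<n))

run-entries : ∀ w {α β τ} → run w α ≡ just (β , τ) → All (OnColumnEntry (LetterEntry w)) τ
run-entries w eq = applyFrom-preserves (length w) 1 (reverse w) eq [] letterEntry
  where
  letterEntry : ∀ t → t < length (reverse w) → LetterEntry w (reverse w ! t) (length w ∸ suc t + 1)
  letterEntry t t<n′ =
    length w ∸ suc t , ∸-monoʳ-< (s≤s z≤n) t<n , sym (reverse-! w t<n) , +-comm (length w ∸ suc t) 1
    where t<n = subst (t <_) (length-reverse w) t<n′

letterEntry-increasing : ∀ (w : List ℕ) k → (∀ p → suc p ≤ k → w ! p ≤ w ! suc p)
                       → ∀ j → ¬ InLeg k w j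
                       → ∀ {a b} → LetterEntry w j a → LetterEntry w (suc j) b → a < b
letterEntry-increasing w k inc j j∉leg (p , p<n , wp≡j , refl) (q , _ , wq≡1+j , refl) with k ≤? p
... | yes k≤p = ⊥-elim (j∉leg (p , k≤p , p<n , wp≡j))
... | no k≰p = s≤s (≰⇒> q≰p)
  where
  q≰p : ¬ q ≤ p
  q≰p q≤p = 1+n≰n (subst₂ _≤_ wq≡1+j wp≡j (!-mono-≤-below w k inc q≤p (<⇒≤ (≰⇒> k≰p))))

lemma5p6 : (α : Composition) → All (λ x → 1 ≤ x) α
    → (w : List ℕ) → All (λ i → 1 ≤ i) w
    → (k : ℕ) → IsRevHookword k w → Connected w
    → (β : Composition) (τ : List Box) → run w α ≡ just (β , τ)
    → (j : ℕ) → 1 ≤ j → InSupp w j → (∃[ j' ] (InSupp w j' × j < j'))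
    → ¬ InLeg k w j
    → ∀ a b → InColumn τ j a → InColumn τ (suc j) b → a < b
lemma5p6 α _ w _ k (_ , inc , _) _ β τ eq j _ _ _ j∉leg a b (_ , a∈τ) (_ , b∈τ) =
  letterEntry-increasing w k inc j j∉leg (lookup entries a∈τ) (lookup entries b∈τ)
  where
  entries : All (OnColumnEntry (LetterEntry w)) τ
  entries = run-entries w eq
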